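{- Let $P(x,y)=y^2-4(x-2)$. Then $P(x,y)$ is a square-free number for every solution $(x,y)$ in positive integers of the negative Pell equation $x^2-2y^2=-1$.
   Context: In this paper "square-free number" is used to mean an integer that is not a perfect square of an integer. -}

module Defs where

open import Data.Integer using (ℤ; _*_; _-_; +_)
open import Data.Product using (∃)
open import Relation.Nullary using (¬_)
open import Relation.Binary.PropositionalEquality using (_≡_)

-- The paper's convention: "square-free number" = an integer that is not
-- the square of an integer.
SquareFree : ℤ → Set
SquareFree n = ¬ (∃ λ (k : ℤ) → k * k ≡ n)

P : ℤ → ℤ → ℤ
P x y = y * y - (+ 4) * (x - + 2)

{-# OPTIONS --safe #-}
-- From x² + 1 = 2y² the number x is odd, hence x² + 1 ≡ 2 (mod 8), so y is odd
-- and y² ≡ 1 (mod 8). Then P(x,y) = y² − 4x + 8 ≡ 1 − 4 ≡ 5 (mod 8), and 5 is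
-- not a square modulo 8.
module Submission where

open import Defs
open import Data.Nat using (ℕ; _<_; _+_; _*_; NonZero)
open import Data.Nat.DivMod using (_%_; %-distribˡ-+; %-distribˡ-*; m%n%n≡m%n; m%n<n)
open import Data.Nat.Properties using (_≟_; allUpTo?)
open import Data.Integer as ℤ using (+_; -[1+_]; -_; ∣_∣)
open import Data.Integer.Properties using (+-injective; pos-*)
open import Data.Integer.Tactic.RingSolver using (solve)
open import Data.List using ([]; _∷_)
open import Function using (_∘_)
open import Data.Product using (_×_; _,_)
open import Relation.Nullary using (¬_; ¬?; Dec)
open import Relation.Nullary.Decidable using (toWitness; _×-dec_; map′)
open import Relation.Binary.PropositionalEquality

infix 4 _≡_[mod_] _≡?_[mod_]

-- A record rather than a synonym for m % d ≡ n % d, so that m and n stay inferable.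
record _≡_[mod_] (m n d : ℕ) .{{_ : NonZero d}} : Set where
  constructor mod-≡
  field residues-≡ : m % d ≡ n % d

_≡?_[mod_] : ∀ m n d .{{_ : NonZero d}} → Dec (m ≡ n [mod d ])
m ≡? n [mod d ] = map′ mod-≡ _≡_[mod_].residues-≡ (m % d ≟ n % d)

module _ {d : ℕ} .{{_ : NonZero d}} where

  refl-mod : ∀ {m} → m ≡ m [mod d ]
  refl-mod = mod-≡ refl

  sym-mod : ∀ {m n} → m ≡ n [mod d ] → n ≡ m [mod d ]
  sym-mod (mod-≡ m≡n) = mod-≡ (sym m≡n)

  trans-mod : ∀ {m n o} → m ≡ n [mod d ] → n ≡ o [mod d ] → m ≡ o [mod d ]
  trans-mod (mod-≡ m≡n) (mod-≡ n≡o) = mod-≡ (trans m≡n n≡o)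

  ≡⇒≡-mod : ∀ {m n} → m ≡ n → m ≡ n [mod d ]
  ≡⇒≡-mod m≡n = mod-≡ (cong (_% d) m≡n)

  %-reduces-mod : ∀ m → m % d ≡ m [mod d ]
  %-reduces-mod m = mod-≡ (m%n%n≡m%n m d)

  +-cong-mod : ∀ {m m′ n n′} → m ≡ m′ [mod d ] → n ≡ n′ [mod d ] → m + n ≡ m′ + n′ [mod d ]
  +-cong-mod {m} {m′} {n} {n′} (mod-≡ m≡m′) (mod-≡ n≡n′) = mod-≡ (begin
    (m + n) % d               ≡⟨ %-distribˡ-+ m n d ⟩
    (m % d + n % d) % d       ≡⟨ cong₂ (λ u v → (u + v) % d) m≡m′ n≡n′ ⟩
    (m′ % d + n′ % d) % d     ≡⟨ %-distribˡ-+ m′ n′ d ⟨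
    (m′ + n′) % d             ∎)
    where open ≡-Reasoning

  *-cong-mod : ∀ {m m′ n n′} → m ≡ m′ [mod d ] → n ≡ n′ [mod d ] → m * n ≡ m′ * n′ [mod d ]
  *-cong-mod {m} {m′} {n} {n′} (mod-≡ m≡m′) (mod-≡ n≡n′) = mod-≡ (begin
    (m * n) % d               ≡⟨ %-distribˡ-* m n d ⟩
    (m % d * (n % d)) % d     ≡⟨ cong₂ (λ u v → (u * v) % d) m≡m′ n≡n′ ⟩
    (m′ % d * (n′ % d)) % d   ≡⟨ %-distribˡ-* m′ n′ d ⟨
    (m′ * n′) % d             ∎)
    where open ≡-Reasoning

-- The Pell equation and k² = P(x,y), read modulo 8 with the subtractions moved across.
PellSquareMod8 : ℕ → ℕ → ℕ → Set
PellSquareMod8 x y k = x * x + 1 ≡ 2 * (y * y) [mod 8 ] × k * k + 4 * x ≡ y * y + 8 [mod 8 ]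

PellSquareMod8-residues : ∀ x y k → PellSquareMod8 x y k → PellSquareMod8 (x % 8) (y % 8) (k % 8)
PellSquareMod8-residues x y k (pell , square) = pell′ , square′
  where
  square-mod : ∀ m → m % 8 * (m % 8) ≡ m * m [mod 8 ]
  square-mod m = *-cong-mod (%-reduces-mod m) (%-reduces-mod m)
  pell′ : x % 8 * (x % 8) + 1 ≡ 2 * (y % 8 * (y % 8)) [mod 8 ]
  pell′ = trans-mod (+-cong-mod (square-mod x) refl-mod)
            (trans-mod pell (*-cong-mod (refl-mod {m = 2}) (sym-mod (square-mod y))))
  square′ : k % 8 * (k % 8) + 4 * (x % 8) ≡ y % 8 * (y % 8) + 8 [mod 8 ]
  square′ = trans-mod (+-cong-mod (square-mod k) (*-cong-mod (refl-mod {m = 4}) (%-reduces-mod x)))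
              (trans-mod square (+-cong-mod (sym-mod (square-mod y)) refl-mod))

PellSquareMod8? : ∀ x y k → Dec (PellSquareMod8 x y k)
PellSquareMod8? x y k = (x * x + 1 ≡? 2 * (y * y) [mod 8 ]) ×-dec (k * k + 4 * x ≡? y * y + 8 [mod 8 ])

no-PellSquareMod8-residues : ∀ {a} → a < 8 → ∀ {b} → b < 8 → ∀ {c} → c < 8 → ¬ PellSquareMod8 a b c
no-PellSquareMod8-residues =
  toWitness {a? = allUpTo? (λ a → allUpTo? (λ b → allUpTo? (λ c → ¬? (PellSquareMod8? a b c)) 8) 8) 8} _

no-PellSquareMod8 : ∀ x y k → ¬ PellSquareMod8 x y k
no-PellSquareMod8 x y k =
  no-PellSquareMod8-residues (m%n<n x 8) (m%n<n y 8) (m%n<n k 8) ∘ PellSquareMod8-residues x y k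

pell-rearranged : ∀ x y → x ℤ.* x ℤ.- + 2 ℤ.* (y ℤ.* y) ≡ - + 1 → x ℤ.* x ℤ.+ + 1 ≡ + 2 ℤ.* (y ℤ.* y)
pell-rearranged x y pell = begin
  x ℤ.* x ℤ.+ + 1                                               ≡⟨ solve (x ∷ y ∷ []) ⟩
  (x ℤ.* x ℤ.- + 2 ℤ.* (y ℤ.* y)) ℤ.+ + 2 ℤ.* (y ℤ.* y) ℤ.+ + 1 ≡⟨ cong (λ t → t ℤ.+ + 2 ℤ.* (y ℤ.* y) ℤ.+ + 1) pell ⟩
  - + 1 ℤ.+ + 2 ℤ.* (y ℤ.* y) ℤ.+ + 1                           ≡⟨ solve (y ∷ []) ⟩
  + 2 ℤ.* (y ℤ.* y)                                             ∎
  where open ≡-Reasoning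

P-rearranged : ∀ k x y → k ℤ.* k ≡ P x y → k ℤ.* k ℤ.+ + 4 ℤ.* x ≡ y ℤ.* y ℤ.+ + 8
P-rearranged k x y k²≡P = begin
  k ℤ.* k ℤ.+ + 4 ℤ.* x                         ≡⟨ cong (ℤ._+ + 4 ℤ.* x) k²≡P ⟩
  P x y ℤ.+ + 4 ℤ.* x                           ≡⟨⟩
  y ℤ.* y ℤ.- + 4 ℤ.* (x ℤ.- + 2) ℤ.+ + 4 ℤ.* x ≡⟨ solve (x ∷ y ∷ []) ⟩
  y ℤ.* y ℤ.+ + 8                               ∎
  where open ≡-Reasoning

square-abs : ∀ k → k ℤ.* k ≡ + ∣ k ∣ ℤ.* + ∣ k ∣
square-abs (+ n)    = refl
square-abs -[1+ n ] = refl

pell-ℕ : ∀ x y → + x ℤ.* + x ℤ.- + 2 ℤ.* (+ y ℤ.* + y) ≡ - + 1 → x * x + 1 ≡ 2 * (y * y)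
pell-ℕ x y pell = +-injective (begin
  + (x * x) ℤ.+ + 1              ≡⟨ cong (ℤ._+ + 1) (pos-* x x) ⟩
  + x ℤ.* + x ℤ.+ + 1            ≡⟨ pell-rearranged (+ x) (+ y) pell ⟩
  + 2 ℤ.* (+ y ℤ.* + y)          ≡⟨ cong (+ 2 ℤ.*_) (pos-* y y) ⟨
  + 2 ℤ.* + (y * y)              ≡⟨ pos-* 2 (y * y) ⟨
  + (2 * (y * y))                ∎)
  where open ≡-Reasoning

P-square-ℕ : ∀ k x y → k ℤ.* k ≡ P (+ x) (+ y) → ∣ k ∣ * ∣ k ∣ + 4 * x ≡ y * y + 8
P-square-ℕ k x y k²≡P = +-injective (begin
  + (∣ k ∣ * ∣ k ∣) ℤ.+ + (4 * x)  ≡⟨ cong₂ ℤ._+_ (trans (pos-* ∣ k ∣ ∣ k ∣) (sym (square-abs k))) (pos-* 4 x) ⟩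
  k ℤ.* k ℤ.+ + 4 ℤ.* + x          ≡⟨ P-rearranged k (+ x) (+ y) k²≡P ⟩
  + y ℤ.* + y ℤ.+ + 8              ≡⟨ cong (ℤ._+ + 8) (pos-* y y) ⟨
  + (y * y) ℤ.+ + 8                ∎)
  where open ≡-Reasoning

lemma2p13 : (x y : ℕ) → 0 < x → 0 < y →
    (+ x) ℤ.* (+ x) ℤ.- (+ 2) ℤ.* ((+ y) ℤ.* (+ y)) ≡ - (+ 1) →
    SquareFree (P (+ x) (+ y))
lemma2p13 x y _ _ pell (k , k²≡P) =
  no-PellSquareMod8 x y ∣ k ∣ (≡⇒≡-mod (pell-ℕ x y pell) , ≡⇒≡-mod (P-square-ℕ k x y k²≡P))
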